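{- Let $n\geq 3$ be an integer, and let $P_n$ and $C_n$ denote the path and the cycle on $n$ vertices. Then $\chi^d_i(P_n)=2$ and $\chi^d_i(C_n)=2$ for every integer $d\geq 1$.
   Context: All graphs are simple. For a graph $G$, an incidence is a pair $(v,e)$ with $v\in V(G)$ an endpoint of the edge $e\in E(G)$; $I(G)$ is the set of all incidences. For $u\in V(G)$ and a neighbor $v$ of $u$, $(u,uv)$ is a strong incidence of $u$ and $(v,uv)$ is a weak incidence of $u$; $I_u$ and $A_u$ denote the sets of strong and weak incidences of $u$. For a map $\varphi$ on $I(G)$, $\varphi(I_u)=\{\varphi(u,uv): v\in N_G(u)\}$. Let $[k]=\{1,\dots,k\}$. A $d$-defective incidence $k$-coloring of $G$ is a map $\varphi: I(G)\to[k]$ such that for every $u\in V(G)$: (a) $\varphi(u,uv)\neq\varphi(u,uw)$ for distinct $v,w\in N_G(u)$; (b) $\varphi(u,uv)\neq\varphi(v,uv)$ for every $v\in N_G(u)$; (c) every color in $\varphi(I_u)$ appears at most $d$ times among the incidences of $A_u$. The $d$-defective incidence chromatic number $\chi^d_i(G)$ is the minimum $k$ such that $G$ has a $d$-defective incidence $k$-coloring. -}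

module Defs where

open import Data.Nat using (ℕ; zero; suc; _≤_; _≥_)
import Data.Nat as ℕ
open import Data.Fin using (Fin; toℕ) renaming (_≟_ to _≟ᶠ_)
open import Data.Bool using (Bool; T; _∨_; _∧_)
open import Data.Bool.Properties using (T?)
open import Data.List using (List; length; filter)
open import Data.List using () renaming (allFin to allFinL)
open import Data.Product using (_×_; Σ)
open import Data.Product.Relation.Unary.All using ()
open import Relation.Nullary using (¬_)
open import Relation.Nullary.Decidable using (_×-dec_; ⌊_⌋)
open import Relation.Binary.PropositionalEquality using (_≡_; _≢_)

-- A graph on the vertex set Fin n, given by a (symmetric, loopless)
-- Boolean adjacency relation.
Adjacency : ℕ → Set
Adjacency n = Fin n → Fin n → Bool

-- An incidence (u, uv) of G is identified with the ordered pair (u , v)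
-- with u adjacent to v.  A map φ on I(G) with values in [k] is represented
-- by a function φ : Fin n → Fin n → Fin k, where φ u v is the color of the
-- incidence (u, uv); values on non-adjacent pairs are irrelevant.
IncMap : ℕ → ℕ → Set
IncMap n k = Fin n → Fin n → Fin k

weakCount : ∀ {n k} → Adjacency n → IncMap n k → Fin n → Fin k → ℕ
weakCount {n} adj φ u c =
  length (filter (λ w → T? (adj u w) ×-dec (φ w u ≟ᶠ c)) (allFinL n))

IsDefIncColoring : ∀ {n} → Adjacency n → (d k : ℕ) → IncMap n k → Set
IsDefIncColoring {n} adj d k φ =
  (u : Fin n) →
    ((v w : Fin n) → T (adj u v) → T (adj u w) → v ≢ w → φ u v ≢ φ u w)
  ×
    ((v : Fin n) → T (adj u v) → φ u v ≢ φ v u)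
  ×
    ((v : Fin n) → T (adj u v) → weakCount adj φ u (φ u v) ≤ d)

HasDefIncColoring : ∀ {n} → Adjacency n → (d k : ℕ) → Set
HasDefIncColoring {n} adj d k = Σ (IncMap n k) (IsDefIncColoring adj d k)

DefIncChromaticNumberIs : ∀ {n} → Adjacency n → (d m : ℕ) → Set
DefIncChromaticNumberIs adj d m =
  HasDefIncColoring adj d m × ((k : ℕ) → HasDefIncColoring adj d k → m ≤ k)

succStep : ∀ {n} → Fin n → Fin n → Bool
succStep i j = ⌊ toℕ j ℕ.≟ suc (toℕ i) ⌋

pathAdj : (n : ℕ) → Adjacency n
pathAdj n i j = succStep i j ∨ succStep j i

wrapStep : ∀ {n} → Fin n → Fin n → Bool
wrapStep {n} i j = ⌊ toℕ i ℕ.≟ 0 ⌋ ∧ ⌊ suc (toℕ j) ℕ.≟ n ⌋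

cycleAdj : (n : ℕ) → Adjacency n
cycleAdj n i j = pathAdj n i j ∨ wrapStep i j ∨ wrapStep j i

{-# OPTIONS --safe #-}
module Submission where

-- Orient the edges of C_n cyclically, i → i+1 and n-1 → 0; for n ≥ 3 every
-- vertex has exactly one out-arc and one in-arc, and the path P_n is a
-- subgraph, so the orientation restricts to it.  Colour the incidence
-- (u, uv) by whether the edge uv leaves u.  The two incidences of an edge get
-- different colours, the two strong incidences of u differ, and all weak
-- incidences of u of one colour come from a single neighbour, so the colouring
-- is even 1-defective.  Conversely any edge forces two colours.

open import Defs
open import Data.Nat using (ℕ; zero; suc; _≤_; _≥_; _<_; z≤n; s≤s)
open import Data.Nat.Properties using (suc-injective; ≤-trans; <-irrefl; m≢1+n+m)
import Data.Nat as ℕ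
open import Data.Bool using (Bool; true; false; not; T; _∨_)
open import Data.Bool.Properties using (T-∨; T-∧; not-injective; ¬-not)
open import Data.Fin using (Fin; toℕ)
open import Data.Fin.Patterns using (0F; 1F)
open import Data.Fin.Properties using (toℕ-injective; toℕ<n; ¬Fin0)
open import Data.List using ([]; _∷_; length; filter)
open import Data.List.Properties using (filter-none)
open import Data.List.Relation.Unary.All as All using ()
open import Data.List.Relation.Unary.AllPairs using (_∷_)
open import Data.List.Relation.Unary.Unique.Propositional using (Unique)
open import Data.List.Relation.Unary.Unique.Propositional.Properties using (allFin⁺)
open import Data.Product using (_×_; _,_; proj₁; proj₂)
open import Data.Sum using (_⊎_; inj₁; inj₂)
open import Data.Empty using (⊥-elim)
open import Data.Unit using (tt)
open import Function using (_∘_; Equivalence)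
open import Level using (Level)
open import Relation.Nullary using (¬_; yes; no; contradiction)
open import Relation.Nullary.Decidable using (toWitness; ⌊_⌋)
open import Relation.Unary using (Pred; Decidable)
open import Relation.Binary.PropositionalEquality using (_≡_; _≢_; refl; sym; trans; subst; module ≡-Reasoning)

open Equivalence using (to; from)

module _ {a p : Level} {A : Set a} {P : Pred A p} (P? : Decidable P)
         (P-unique : ∀ {x y} → P x → P y → x ≡ y) where

  length-filter-unique≤1 : ∀ {xs} → Unique xs → length (filter P? xs) ≤ 1
  length-filter-unique≤1 {[]}     _          = z≤n
  length-filter-unique≤1 {x ∷ xs} (x∉ ∷ uxs) with P? x
  ... | no  _  = length-filter-unique≤1 uxs
  ... | yes px rewrite filter-none P? (All.map (λ x≢y py → x≢y (P-unique px py)) x∉) = s≤s z≤n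

two≤colours : ∀ {n} {adj : Adjacency n} {d k : ℕ} {u v : Fin n} →
              T (adj u v) → HasDefIncColoring adj d k → 2 ≤ k
two≤colours {k = zero}        {u} {v} _   (φ , _) = ⊥-elim (¬Fin0 (φ u v))
two≤colours {k = suc (suc _)}         _   _       = s≤s (s≤s z≤n)
two≤colours {k = suc zero}    {u} {v} uv (φ , φ-colouring) =
  ⊥-elim (proj₁ (proj₂ (φ-colouring u)) v uv (Fin1-≡ (φ u v) (φ v u)))
  where
  Fin1-≡ : (i j : Fin 1) → i ≡ j
  Fin1-≡ 0F 0F = refl

record Orientation {n : ℕ} (adj : Adjacency n) : Set where
  field
    arc        : Fin n → Fin n → Bool
    oriented   : ∀ {u v} → T (adj u v) → T (arc u v) ⊎ T (arc v u)
    asymmetric : ∀ {u v} → T (arc u v) → ¬ T (arc v u)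
    out-unique : ∀ {u v w} → T (arc u v) → T (arc u w) → v ≡ w
    in-unique  : ∀ {u v w} → T (arc v u) → T (arc w u) → v ≡ w

Orientation-restrict : ∀ {n} {adj adj′ : Adjacency n} →
                       (∀ u v → T (adj u v) → T (adj′ u v)) →
                       Orientation adj′ → Orientation adj
Orientation-restrict adj⊆adj′ O = record
  { arc = arc ; oriented = λ {u} {v} → oriented ∘ adj⊆adj′ u v
  ; asymmetric = asymmetric ; out-unique = out-unique ; in-unique = in-unique }
  where open Orientation O

colour : Bool → Fin 2
colour true  = 0F
colour false = 1F

colour-injective : ∀ {a b} → colour a ≡ colour b → a ≡ b
colour-injective {true}  {true}  _ = refl
colour-injective {false} {false} _ = refl

module OrientationColouring {n : ℕ} {adj : Adjacency n} (O : Orientation adj) where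
  open Orientation O

  φ : IncMap n 2
  φ u v = colour (arc u v)

  arc-≢ : ∀ {u v} → T (adj u v) → arc u v ≢ arc v u
  arc-≢ uv eq with oriented uv
  ... | inj₁ uv⃗ = asymmetric uv⃗ (subst T eq uv⃗)
  ... | inj₂ vu⃗ = asymmetric vu⃗ (subst T (sym eq) vu⃗)

  strong-arc-unique : ∀ {u v w} → T (adj u v) → T (adj u w) → arc u v ≡ arc u w → v ≡ w
  strong-arc-unique uv uw eq with oriented uv | oriented uw
  ... | inj₁ uv⃗ | inj₁ uw⃗ = out-unique uv⃗ uw⃗
  ... | inj₂ vu⃗ | inj₂ wu⃗ = in-unique vu⃗ wu⃗
  ... | inj₁ uv⃗ | inj₂ wu⃗ = contradiction wu⃗ (asymmetric (subst T eq uv⃗))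
  ... | inj₂ vu⃗ | inj₁ uw⃗ = contradiction vu⃗ (asymmetric (subst T (sym eq) uw⃗))

  weak-arc-unique : ∀ {u v w} → T (adj u v) → T (adj u w) → arc v u ≡ arc w u → v ≡ w
  weak-arc-unique {u} {v} {w} uv uw eq = strong-arc-unique uv uw (not-injective (begin
    not (arc u v)  ≡⟨ sym (¬-not (arc-≢ uv ∘ sym)) ⟩
    arc v u        ≡⟨ eq ⟩
    arc w u        ≡⟨ ¬-not (arc-≢ uw ∘ sym) ⟩
    not (arc u w)  ∎))
    where open ≡-Reasoning

  isDefIncColoring : ∀ d → d ≥ 1 → IsDefIncColoring adj d 2 φ
  isDefIncColoring d d≥1 u =
      (λ v w uv uw v≢w → v≢w ∘ strong-arc-unique uv uw ∘ colour-injective)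
    , (λ v uv → arc-≢ uv ∘ colour-injective)
    , (λ v _ → ≤-trans (length-filter-unique≤1 _ same-weak-colour (allFin⁺ n)) d≥1)
    where
    same-weak-colour : ∀ {c w w′} → T (adj u w) × φ w u ≡ c → T (adj u w′) × φ w′ u ≡ c → w ≡ w′
    same-weak-colour (uw , refl) (uw′ , eq) = weak-arc-unique uw uw′ (colour-injective (sym eq))

chromaticNumber≡2 : ∀ {n} {adj : Adjacency n} {d : ℕ} (u v : Fin n) →
                    T (adj u v) → Orientation adj → d ≥ 1 → DefIncChromaticNumberIs adj d 2
chromaticNumber≡2 _ _ uv O d≥1 =
  (φ , isDefIncColoring _ d≥1) , λ _ → two≤colours uv
  where open OrientationColouring O

CycleStep : ℕ → ℕ → ℕ → Set
CycleStep n x y = y ≡ suc x ⊎ (y ≡ 0 × suc x ≡ n)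

cycleStep-asym : ∀ {n x y} → 3 ≤ n → CycleStep n x y → ¬ CycleStep n y x
cycleStep-asym (s≤s ()) (inj₂ (refl , refl)) (inj₂ (refl , _))
cycleStep-asym _ (inj₁ refl) (inj₁ x≡2+x) = contradiction x≡2+x (m≢1+n+m _)
cycleStep-asym (s≤s (s≤s ())) (inj₁ refl) (inj₂ (refl , refl))
cycleStep-asym (s≤s (s≤s ())) (inj₂ (refl , refl)) (inj₁ refl)

cycleStep-functional : ∀ {n x y z} → y < n → z < n → CycleStep n x y → CycleStep n x z → y ≡ z
cycleStep-functional _ _ (inj₁ refl) (inj₁ refl) = refl
cycleStep-functional y<n _ (inj₁ refl) (inj₂ (_ , refl)) = contradiction y<n (<-irrefl refl)
cycleStep-functional _ z<n (inj₂ (_ , refl)) (inj₁ refl) = contradiction z<n (<-irrefl refl)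
cycleStep-functional _ _ (inj₂ (refl , _)) (inj₂ (refl , _)) = refl

cycleStep-injective : ∀ {n x y z} → CycleStep n x z → CycleStep n y z → x ≡ y
cycleStep-injective (inj₁ refl) (inj₁ 1+x≡1+y) = suc-injective 1+x≡1+y
cycleStep-injective (inj₁ refl) (inj₂ (() , _))
cycleStep-injective (inj₂ (refl , _)) (inj₁ ())
cycleStep-injective (inj₂ (_ , 1+x≡n)) (inj₂ (_ , 1+y≡n)) = suc-injective (trans 1+x≡n (sym 1+y≡n))

cycleArc : (n : ℕ) → Fin n → Fin n → Bool
cycleArc n u v = succStep u v ∨ wrapStep v u

T-cycleArc : ∀ {n} (u v : Fin n) → T (cycleArc n u v) → CycleStep n (toℕ u) (toℕ v)
T-cycleArc u v uv⃗ with to (T-∨ {succStep u v}) uv⃗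
... | inj₁ succ = inj₁ (toWitness succ)
... | inj₂ wrap with to (T-∧ {⌊ toℕ v ℕ.≟ 0 ⌋}) wrap
...   | v≡0 , 1+u≡n = inj₂ (toWitness v≡0 , toWitness 1+u≡n)

cycleArc-oriented : ∀ {n} {u v : Fin n} → T (cycleAdj n u v) → T (cycleArc n u v) ⊎ T (cycleArc n v u)
cycleArc-oriented {n} {u} {v} uv with to (T-∨ {pathAdj n u v}) uv
... | inj₁ p with to (T-∨ {succStep u v}) p
...   | inj₁ succ = inj₁ (from T-∨ (inj₁ succ))
...   | inj₂ succ = inj₂ (from T-∨ (inj₁ succ))
cycleArc-oriented {n} {u} {v} uv | inj₂ w with to (T-∨ {wrapStep u v}) w
...   | inj₁ wrap = inj₂ (from T-∨ (inj₂ wrap))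
...   | inj₂ wrap = inj₁ (from T-∨ (inj₂ wrap))

cycleOrientation : ∀ {n} → 3 ≤ n → Orientation (cycleAdj n)
cycleOrientation n≥3 = record
  { arc        = cycleArc _
  ; oriented   = λ {u} {v} → cycleArc-oriented {u = u} {v}
  ; asymmetric = λ {u} {v} uv⃗ vu⃗ →
      cycleStep-asym n≥3 (T-cycleArc u v uv⃗) (T-cycleArc v u vu⃗)
  ; out-unique = λ {u} {v} {w} uv⃗ uw⃗ → toℕ-injective
      (cycleStep-functional (toℕ<n v) (toℕ<n w) (T-cycleArc u v uv⃗) (T-cycleArc u w uw⃗))
  ; in-unique  = λ {u} {v} {w} vu⃗ wu⃗ → toℕ-injective
      (cycleStep-injective (T-cycleArc v u vu⃗) (T-cycleArc w u wu⃗))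
  }

pathAdj⊆cycleAdj : ∀ n (u v : Fin n) → T (pathAdj n u v) → T (cycleAdj n u v)
pathAdj⊆cycleAdj n u v = from (T-∨ {pathAdj n u v}) ∘ inj₁

theorem1 : (n : ℕ) → n ≥ 3 → (d : ℕ) → d ≥ 1 →
    DefIncChromaticNumberIs (pathAdj n) d 2 × DefIncChromaticNumberIs (cycleAdj n) d 2
theorem1 n n≥3@(s≤s (s≤s (s≤s _))) _ d≥1 =
    chromaticNumber≡2 0F 1F edge₀₁ (Orientation-restrict (pathAdj⊆cycleAdj n) Cₙ) d≥1
  , chromaticNumber≡2 0F 1F (pathAdj⊆cycleAdj n 0F 1F edge₀₁) Cₙ d≥1
  where
  Cₙ : Orientation (cycleAdj n)
  Cₙ = cycleOrientation n≥3
  edge₀₁ : T (pathAdj n 0F 1F)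
  edge₀₁ = tt
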